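{- Let $M=(v_1,\dots,v_n)$ be a generating list of nonzero vectors of $\mathbb{F}_2^r$, $G=G(\mathbb{F}_2^r,M)$, and for $u\in\mathbb{F}_2^r$ let $\lambda_u=n-\sum_{i=1}^n(-1)^{u\cdot v_i}$. Fix $1\le j\le r$. Then the additive order of $x_j-1$ in $K(G)$ is equal to the minimum positive integer $C$ such that for every $v\in\mathbb{F}_2^r$, \[\frac{C}{2^{r-2}}\sum_{\substack{u\in\mathbb{F}_2^r:\ u\cdot v=1\\ u_j=1}}\frac{1}{\lambda_u}\in\mathbb{Z}.\]
   Context: $G(\mathbb{F}_2^r,M)$ is the multigraph with vertex set $\mathbb{F}_2^r$ and one edge between $w$ and $w+v_i$ for each vertex $w$ and each $i$; $L(G)$ is its Laplacian, whose eigenvalues are the $\lambda_u$ (positive for $u\neq 0$). The sandpile group $K(G)$ is the torsion subgroup of $\operatorname{coker}L(G)$, and $\operatorname{coker}L(G)\cong \mathbb{Z}[x_1,\dots,x_r]/(x_1^2-1,\dots,x_r^2-1,\ n-\sum_{i=1}^n\prod_{j=1}^r x_j^{(v_i)_j})$, where the monomial $\prod_j x_j^{u_j}$ corresponds to the basis vector $e_u\in\mathbb{Z}^{2^r}$; under this identification $x_j-1$ is a torsion element, i.e. lies in $K(G)$. -}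

module Defs where

open import Data.Bool using (Bool; true; false; _xor_; _∧_; if_then_else_)
open import Data.Bool.Properties using () renaming (_≟_ to _≟𝔹_)
open import Data.Nat as ℕ using (ℕ; zero; suc; _≤_; _<_; _^_)
open import Data.Nat.Properties using (m^n≢0)
open import Data.Integer as ℤ using (ℤ; +_; -[1+_])
open import Data.Rational as ℚ using (ℚ; _/_; 0ℚ)
open import Data.Vec as Vec using (Vec; []; _∷_; zipWith; replicate; lookup)
open import Data.Vec.Properties using (≡-dec)
open import Data.List as List using (List; [_]; _++_)
open import Data.Fin using (Fin)
open import Data.Product using (Σ; ∃; _×_)
open import Relation.Nullary.Decidable using (⌊_⌋)
open import Relation.Binary.PropositionalEquality using (_≡_; _≢_)

F2 : ℕ → Set
F2 r = Vec Bool r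

_⊕_ : ∀ {r} → F2 r → F2 r → F2 r
_⊕_ = zipWith _xor_

zeroV : ∀ {r} → F2 r
zeroV = replicate _ false

dot : ∀ {r} → F2 r → F2 r → Bool
dot [] [] = false
dot (a ∷ u) (b ∷ v) = (a ∧ b) xor dot u v

basis : ∀ {r} → Fin r → F2 r
basis {suc r} Fin.zero = true ∷ zeroV
basis {suc r} (Fin.suc j) = false ∷ basis j

_≟V_ : ∀ {r} (u w : F2 r) → _
_≟V_ = ≡-dec _≟𝔹_

allVecs : (r : ℕ) → List (F2 r)
allVecs zero = [ [] ]
allVecs (suc r) = List.map (false ∷_) (allVecs r) ++ List.map (true ∷_) (allVecs r)

subsetSum : ∀ {r n} → Vec (F2 r) n → Vec Bool n → F2 r
subsetSum [] [] = zeroV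
subsetSum (v ∷ M) (b ∷ s) = (if b then v else zeroV) ⊕ subsetSum M s

Generates : ∀ {r n} → Vec (F2 r) n → Set
Generates {r} M = ∀ (w : F2 r) → ∃ λ s → subsetSum M s ≡ w

AllNonzero : ∀ {r n} → Vec (F2 r) n → Set
AllNonzero {n = n} M = ∀ (i : Fin n) → lookup M i ≢ zeroV

sumℤ : ∀ {k} → Vec ℤ k → ℤ
sumℤ = Vec.foldr _ ℤ._+_ (+ 0)

sumℚ : List ℚ → ℚ
sumℚ = List.foldr ℚ._+_ 0ℚ

-- Laplacian of G(F_2^r, M) acting on Z^{F_2^r}:
-- (L f)(w) = n f(w) - Σ_i f(w + v_i)   (degree n, A(w,w') = #{i : w' = w + v_i})
laplacian : ∀ {r n} → Vec (F2 r) n → (F2 r → ℤ) → (F2 r → ℤ)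
laplacian {n = n} M f w = (+ n) ℤ.* f w ℤ.- sumℤ (Vec.map (λ v → f (w ⊕ v)) M)

InImage : ∀ {r n} → Vec (F2 r) n → (F2 r → ℤ) → Set
InImage {r} M g = ∃ λ (f : F2 r → ℤ) → ∀ w → laplacian M f w ≡ g w

IsLeastPos : (ℕ → Set) → ℕ → Set
IsLeastPos P C = (0 < C) × P C × (∀ D → 0 < D → P D → C ≤ D)

-- C is the additive order of the class of g in coker L(G)
IsOrderInCoker : ∀ {r n} → Vec (F2 r) n → (F2 r → ℤ) → ℕ → Set
IsOrderInCoker M g = IsLeastPos (λ D → InImage M (λ w → (+ D) ℤ.* g w))

indicator : ∀ {r} → F2 r → (F2 r → ℤ)
indicator u w = if ⌊ u ≟V w ⌋ then + 1 else + 0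

-- x_j - 1  ↔  e_{e_j} - e_0
xMinus1 : ∀ {r} → Fin r → (F2 r → ℤ)
xMinus1 j w = indicator (basis j) w ℤ.- indicator zeroV w

eigen : ∀ {r n} → Vec (F2 r) n → F2 r → ℤ
eigen {n = n} M u = (+ n) ℤ.- sumℤ (Vec.map (λ v → if dot u v then ℤ.-[1+ 0 ] else + 1) M)

-- 1/z in ℚ (convention 1/0 = 0; never used under the hypotheses)
recip : ℤ → ℚ
recip (+ zero) = 0ℚ
recip (+ suc k) = + 1 / suc k
recip -[1+ k ] = -[1+ 0 ] / suc k

innerSum : ∀ {r n} → Vec (F2 r) n → Fin r → F2 r → ℚ
innerSum {r} M j v =
  sumℚ (List.map (λ u → if dot u v ∧ lookup u j then recip (eigen M u) else 0ℚ) (allVecs r))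

-- C / 2^(r-2) as a rational, written 4C / 2^r
scale : ℕ → ℕ → ℚ
scale r C = _/_ (+ (4 ℕ.* C)) (2 ^ r) {{m^n≢0 2 r}}

IsInteger : ℚ → Set
IsInteger q = ∃ λ (z : ℤ) → q ≡ z / 1

IntegralityCondition : ∀ {r n} → Vec (F2 r) n → Fin r → ℕ → Set
IntegralityCondition {r} M j C = ∀ (v : F2 r) → IsInteger (scale r C ℚ.* innerSum M j v)

-- For u ∈ F₂ʳ let ψ_u be the indicator of {w : u·w = 1} and k_u = #{i : u·vᵢ = 1}.  Then
-- L ψ_u = k_u (2ψ_u − 1) and λ_u = 2k_u, and k_u > 0 for u ≠ 0 because M generates F₂ʳ.
-- Summing over u with u_j = 1 and using the orthogonality of the characters (−1)^(u·w),
-- the potential S(v) = 2^(2−r) Σ_{u·v = 1, u_j = 1} 1/λ_u solves L S = x_j − 1.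
-- Hence D(x_j − 1) = L f with f integral iff f − D S is harmonic; on the connected graph G
-- harmonic functions are constant (maximum principle), and S(0) = 0, so this happens iff
-- D S is integer-valued.  That condition is decidable and holds for a common denominator,
-- so the least such D exists, and it is the order of x_j − 1.

module Submission where

open import Defs
open import Data.Nat using (ℕ)
open import Data.Fin using (Fin)
open import Data.Vec using (Vec)
open import Data.Product using (∃; _×_)

open import Algebra.Bundles using (CommutativeRing)
open import Data.Bool using (Bool; true; false; not; _xor_; _∧_; if_then_else_)
import Data.Bool.Properties as 𝔹
open import Data.Empty using (⊥-elim)
open import Data.Fin using (zero; suc)
open import Data.Integer as ℤ using (ℤ; +_)
import Data.Integer.Properties as ℤP
import Data.Integer.Tactic.RingSolver as ℤRing
open import Data.List as List using (List; []; _∷_; _++_)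
import Data.List.Properties as ListP
open import Data.Nat as ℕ using (zero; suc; _^_; z≤n; s≤s)
import Data.Nat.Coprimality as Coprime
import Data.Nat.Properties as ℕP
import Data.Nat.Tactic.RingSolver as ℕRing
open import Data.Product using (_,_; proj₁; proj₂)
open import Data.Rational as ℚ using (ℚ; mkℚ; _/_; 0ℚ; 1ℚ; ↥_; ↧ₙ_; toℚᵘ; _+_; _*_; _-_; -_; _≤_)
import Data.Rational.Properties as ℚP
open import Data.Rational.Solver using (module +-*-Solver)
open import Data.Rational.Unnormalised as ℚᵘ using (mkℚᵘ; *≡*) renaming (_≃_ to _≃ᵘ_)
import Data.Rational.Unnormalised.Properties as ℚᵘP
open import Data.Sum using (_⊎_; inj₁; inj₂; [_,_]′)
open import Data.Vec as Vec using ([]; _∷_; lookup)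
open import Data.Vec.Properties using (zipWith-assoc; zipWith-identityˡ; zipWith-identityʳ; ∷-injective)
open import Relation.Binary.PropositionalEquality
open import Relation.Nullary using (Dec; yes; no; ¬_)
open import Relation.Nullary.Decidable using (map′; _×-dec_)

open +-*-Solver using (solve; _:+_; _:*_; _:-_; _:=_; con)

-- IsInteger q unfolds to ∃ λ z → q ≡ fromℤ z.

fromℤ : ℤ → ℚ
fromℤ i = i / 1

toℚᵘ-/ : ∀ i n .{{_ : ℕ.NonZero n}} → toℚᵘ (i / n) ≃ᵘ (i ℚᵘ./ n)
toℚᵘ-/ i (suc m) = ℚP.toℚᵘ-fromℚᵘ (mkℚᵘ i m)

≡-viaℚᵘ : ∀ {p q x y} → toℚᵘ p ≃ᵘ x → toℚᵘ q ≃ᵘ y → x ≃ᵘ y → p ≡ q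
≡-viaℚᵘ p≃x q≃y x≃y = ℚP.toℚᵘ-injective (ℚᵘP.≃-trans p≃x (ℚᵘP.≃-trans x≃y (ℚᵘP.≃-sym q≃y)))

toℚᵘ-+ : ∀ {p q x y} → toℚᵘ p ≃ᵘ x → toℚᵘ q ≃ᵘ y → toℚᵘ (p + q) ≃ᵘ x ℚᵘ.+ y
toℚᵘ-+ {p} {q} p≃x q≃y = ℚᵘP.≃-trans (ℚP.toℚᵘ-homo-+ p q) (ℚᵘP.+-cong p≃x q≃y)

toℚᵘ-* : ∀ {p q x y} → toℚᵘ p ≃ᵘ x → toℚᵘ q ≃ᵘ y → toℚᵘ (p * q) ≃ᵘ x ℚᵘ.* y
toℚᵘ-* {p} {q} p≃x q≃y = ℚᵘP.≃-trans (ℚP.toℚᵘ-homo-* p q) (ℚᵘP.*-cong p≃x q≃y)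

fromℤ-+ : ∀ i j → fromℤ (i ℤ.+ j) ≡ fromℤ i + fromℤ j
fromℤ-+ i j = ≡-viaℚᵘ (toℚᵘ-/ (i ℤ.+ j) 1) (toℚᵘ-+ (toℚᵘ-/ i 1) (toℚᵘ-/ j 1))
  (*≡* (cong (ℤ._* + 1) (sym (cong₂ ℤ._+_ (ℤP.*-identityʳ i) (ℤP.*-identityʳ j)))))

fromℤ-* : ∀ i j → fromℤ (i ℤ.* j) ≡ fromℤ i * fromℤ j
fromℤ-* i j = ≡-viaℚᵘ (toℚᵘ-/ (i ℤ.* j) 1) (toℚᵘ-* (toℚᵘ-/ i 1) (toℚᵘ-/ j 1)) ℚᵘP.≃-refl

fromℤ-neg : ∀ i → fromℤ (ℤ.- i) ≡ - fromℤ i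
fromℤ-neg i = ≡-viaℚᵘ (toℚᵘ-/ (ℤ.- i) 1)
  (ℚᵘP.≃-trans (ℚP.toℚᵘ-homo‿- (fromℤ i)) (ℚᵘP.-‿cong (toℚᵘ-/ i 1))) ℚᵘP.≃-refl

fromℤ-- : ∀ i j → fromℤ (i ℤ.- j) ≡ fromℤ i - fromℤ j
fromℤ-- i j = trans (fromℤ-+ i (ℤ.- j)) (cong (λ x → fromℤ i + x) (fromℤ-neg j))

fromℤ-injective : ∀ {i j} → fromℤ i ≡ fromℤ j → i ≡ j
fromℤ-injective {i} {j} eq
  with ℚᵘP.≃-trans (ℚᵘP.≃-sym (toℚᵘ-/ i 1)) (ℚᵘP.≃-trans (ℚP.toℚᵘ-cong eq) (toℚᵘ-/ j 1))
... | *≡* i*1≡j*1 = trans (sym (ℤP.*-identityʳ i)) (trans i*1≡j*1 (ℤP.*-identityʳ j))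

fromℤ≡mkℚ : ∀ i → fromℤ i ≡ mkℚ i 0 (Coprime.sym (Coprime.1-coprimeTo _))
fromℤ≡mkℚ (+ n) = ℚP.normalize-coprime {n} {0} (Coprime.sym (Coprime.1-coprimeTo _))
fromℤ≡mkℚ ℤ.-[1+ n ] = cong -_ (ℚP.normalize-coprime {suc n} {0} (Coprime.sym (Coprime.1-coprimeTo _)))

*-/ : ∀ i j n .{{_ : ℕ.NonZero n}} → (i ℤ.* j) / n ≡ fromℤ i * (j / n)
*-/ i j n@(suc m) = ≡-viaℚᵘ (toℚᵘ-/ (i ℤ.* j) n) (toℚᵘ-* (toℚᵘ-/ i 1) (toℚᵘ-/ j n))
  (*≡* (cong (λ d → (i ℤ.* j) ℤ.* + suc d) (ℕP.+-identityʳ m)))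

[i*n]/n≡i : ∀ i n .{{_ : ℕ.NonZero n}} → (i ℤ.* + n) / n ≡ fromℤ i
[i*n]/n≡i i n@(suc _) = ≡-viaℚᵘ (toℚᵘ-/ (i ℤ.* + n) n) (toℚᵘ-/ i 1) (*≡* (ℤP.*-identityʳ (i ℤ.* + n)))

n*[1/n]≡1 : ∀ n .{{_ : ℕ.NonZero n}} → fromℤ (+ n) * (+ 1 / n) ≡ 1ℚ
n*[1/n]≡1 n = begin
  fromℤ (+ n) * (+ 1 / n) ≡⟨ *-/ (+ n) (+ 1) n ⟨
  (+ n ℤ.* + 1) / n       ≡⟨ cong (λ i → i / n) (ℤP.*-comm (+ n) (+ 1)) ⟩
  (+ 1 ℤ.* + n) / n       ≡⟨ [i*n]/n≡i (+ 1) n ⟩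
  1ℚ                      ∎
  where open ≡-Reasoning

[1/2k]*k≡1/2 : ∀ k → (+ 1 / (suc k ℕ.+ suc k)) * fromℤ (+ suc k) ≡ + 1 / 2
[1/2k]*k≡1/2 k = begin
  (+ 1 / (suc k ℕ.+ suc k)) * fromℤ (+ suc k) ≡⟨ ℚP.*-comm _ (fromℤ (+ suc k)) ⟩
  fromℤ (+ suc k) * (+ 1 / (suc k ℕ.+ suc k)) ≡⟨ *-/ (+ suc k) (+ 1) (suc k ℕ.+ suc k) ⟨
  (+ suc k ℤ.* + 1) / (suc k ℕ.+ suc k)
    ≡⟨ ≡-viaℚᵘ (toℚᵘ-/ (+ suc k ℤ.* + 1) (suc k ℕ.+ suc k)) (toℚᵘ-/ (+ 1) 2) (*≡* (cong +_ (k*2≡k+k (suc k)))) ⟩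
  + 1 / 2                                     ∎
  where
  open ≡-Reasoning
  k*2≡k+k : ∀ k → k ℕ.* 1 ℕ.* 2 ≡ 1 ℕ.* (k ℕ.+ k)
  k*2≡k+k = ℕRing.solve-∀

denominator*q≡numerator : ∀ q → fromℤ (+ ↧ₙ q) * q ≡ fromℤ (↥ q)
denominator*q≡numerator q@(mkℚ n d _) = begin
  fromℤ (+ suc d) * q             ≡⟨ cong (fromℤ (+ suc d) *_) (ℚP.↥p/↧p≡p q) ⟨
  fromℤ (+ suc d) * (n / suc d)   ≡⟨ *-/ (+ suc d) n (suc d) ⟨
  (+ suc d ℤ.* n) / suc d         ≡⟨ cong (λ i → i / suc d) (ℤP.*-comm (+ suc d) n) ⟩
  (n ℤ.* + suc d) / suc d         ≡⟨ [i*n]/n≡i n (suc d) ⟩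
  fromℤ n                         ∎
  where open ≡-Reasoning

sumℚ-map-cong : ∀ {A : Set} {f g : A → ℚ} → (∀ x → f x ≡ g x) → ∀ xs →
                sumℚ (List.map f xs) ≡ sumℚ (List.map g xs)
sumℚ-map-cong f≗g []       = refl
sumℚ-map-cong f≗g (x ∷ xs) = cong₂ _+_ (f≗g x) (sumℚ-map-cong f≗g xs)

sumℚ-map-0 : ∀ {A : Set} (xs : List A) → sumℚ (List.map (λ _ → 0ℚ) xs) ≡ 0ℚ
sumℚ-map-0 []       = refl
sumℚ-map-0 (x ∷ xs) = cong (_+_ 0ℚ) (sumℚ-map-0 xs)

sumℚ-map-+ : ∀ {A : Set} (f g : A → ℚ) xs →
             sumℚ (List.map (λ x → f x + g x) xs) ≡ sumℚ (List.map f xs) + sumℚ (List.map g xs)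
sumℚ-map-+ f g []       = refl
sumℚ-map-+ f g (x ∷ xs) = trans (cong (_+_ (f x + g x)) (sumℚ-map-+ f g xs))
  (solve 4 (λ a b c d → (a :+ b) :+ (c :+ d) := (a :+ c) :+ (b :+ d)) refl
     (f x) (g x) (sumℚ (List.map f xs)) (sumℚ (List.map g xs)))

sumℚ-map-neg : ∀ {A : Set} (f : A → ℚ) xs → sumℚ (List.map (λ x → - f x) xs) ≡ - sumℚ (List.map f xs)
sumℚ-map-neg f []       = refl
sumℚ-map-neg f (x ∷ xs) = trans (cong (_+_ (- f x)) (sumℚ-map-neg f xs)) (sym (ℚP.neg-distrib-+ (f x) _))

sumℚ-map-- : ∀ {A : Set} (f g : A → ℚ) xs →
             sumℚ (List.map (λ x → f x - g x) xs) ≡ sumℚ (List.map f xs) - sumℚ (List.map g xs)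
sumℚ-map-- f g xs = trans (sumℚ-map-+ f (λ x → - g x) xs) (cong (_+_ (sumℚ (List.map f xs))) (sumℚ-map-neg g xs))

sumℚ-map-*ˡ : ∀ {A : Set} c (f : A → ℚ) xs → sumℚ (List.map (λ x → c * f x) xs) ≡ c * sumℚ (List.map f xs)
sumℚ-map-*ˡ c f []       = sym (ℚP.*-zeroʳ c)
sumℚ-map-*ˡ c f (x ∷ xs) = trans (cong (_+_ (c * f x)) (sumℚ-map-*ˡ c f xs)) (sym (ℚP.*-distribˡ-+ c (f x) _))

sumℚ-++ : ∀ xs ys → sumℚ (xs ++ ys) ≡ sumℚ xs + sumℚ ys
sumℚ-++ []       ys = sym (ℚP.+-identityˡ _)
sumℚ-++ (x ∷ xs) ys = trans (cong (_+_ x) (sumℚ-++ xs ys)) (sym (ℚP.+-assoc x _ _))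

∑ : ∀ r → (F2 r → ℚ) → ℚ
∑ r f = sumℚ (List.map f (allVecs r))

∑-suc : ∀ r (f : F2 (suc r) → ℚ) → ∑ (suc r) f ≡ ∑ r (λ u → f (false ∷ u)) + ∑ r (λ u → f (true ∷ u))
∑-suc r f = begin
  sumℚ (List.map f (List.map (false ∷_) us ++ List.map (true ∷_) us))
    ≡⟨ cong sumℚ (ListP.map-++ f (List.map (false ∷_) us) (List.map (true ∷_) us)) ⟩
  sumℚ (List.map f (List.map (false ∷_) us) ++ List.map f (List.map (true ∷_) us))
    ≡⟨ sumℚ-++ (List.map f (List.map (false ∷_) us)) _ ⟩
  sumℚ (List.map f (List.map (false ∷_) us)) + sumℚ (List.map f (List.map (true ∷_) us))
    ≡⟨ cong₂ (λ xs ys → sumℚ xs + sumℚ ys) (ListP.map-∘ us) (ListP.map-∘ us) ⟨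
  ∑ r (λ u → f (false ∷ u)) + ∑ r (λ u → f (true ∷ u)) ∎
  where
  open ≡-Reasoning
  us = allVecs r

⊕-assoc : ∀ {r} (x y z : F2 r) → (x ⊕ y) ⊕ z ≡ x ⊕ (y ⊕ z)
⊕-assoc = zipWith-assoc 𝔹.xor-assoc

⊕-identityˡ : ∀ {r} (x : F2 r) → zeroV ⊕ x ≡ x
⊕-identityˡ = zipWith-identityˡ 𝔹.xor-identityˡ

⊕-identityʳ : ∀ {r} (x : F2 r) → x ⊕ zeroV ≡ x
⊕-identityʳ = zipWith-identityʳ 𝔹.xor-identityʳ

x⊕x≡0 : ∀ {r} (x : F2 r) → x ⊕ x ≡ zeroV
x⊕x≡0 []      = refl
x⊕x≡0 (a ∷ x) = cong₂ _∷_ (𝔹.xor-same a) (x⊕x≡0 x)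

x⊕[x⊕y]≡y : ∀ {r} (x y : F2 r) → x ⊕ (x ⊕ y) ≡ y
x⊕[x⊕y]≡y x y = trans (sym (⊕-assoc x x y)) (trans (cong (_⊕ y) (x⊕x≡0 x)) (⊕-identityˡ y))

dot-⊕ʳ : ∀ {r} (u w v : F2 r) → dot u (w ⊕ v) ≡ dot u w xor dot u v
dot-⊕ʳ []      []      []      = refl
dot-⊕ʳ (a ∷ u) (b ∷ w) (c ∷ v) =
  trans (cong₂ _xor_ (𝔹.∧-distribˡ-xor a b c) (dot-⊕ʳ u w v)) (xor-interchange (a ∧ b) (a ∧ c) (dot u w) (dot u v))
  where open import Algebra.Properties.CommutativeSemigroup
          (CommutativeRing.+-commutativeSemigroup 𝔹.xor-∧-commutativeRing)
          renaming (interchange to xor-interchange)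

dot-zeroʳ : ∀ {r} (u : F2 r) → dot u zeroV ≡ false
dot-zeroʳ []      = refl
dot-zeroʳ (a ∷ u) = cong₂ _xor_ (𝔹.∧-zeroʳ a) (dot-zeroʳ u)

dot-basisʳ : ∀ {r} (u : F2 r) (j : Fin r) → dot u (basis j) ≡ lookup u j
dot-basisʳ (a ∷ u) zero    = trans (cong₂ _xor_ (𝔹.∧-identityʳ a) (dot-zeroʳ u)) (𝔹.xor-identityʳ a)
dot-basisʳ (a ∷ u) (suc j) = cong₂ _xor_ (𝔹.∧-zeroʳ a) (dot-basisʳ u j)

indicator-≡ : ∀ {r s} {a b : F2 r} {c d : F2 s} → (a ≡ b → c ≡ d) → (c ≡ d → a ≡ b) → indicator a b ≡ indicator c d
indicator-≡ {a = a} {b} {c} {d} to from with a ≟V b | c ≟V d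
... | yes _   | yes _   = refl
... | no _    | no _    = refl
... | yes a≡b | no c≢d  = ⊥-elim (c≢d (to a≡b))
... | no a≢b  | yes c≡d = ⊥-elim (a≢b (from c≡d))

indicator-≢ : ∀ {r} {a b : F2 r} → ¬ a ≡ b → indicator a b ≡ + 0
indicator-≢ {a = a} {b} a≢b with a ≟V b
... | yes a≡b = ⊥-elim (a≢b a≡b)
... | no _    = refl

indicator-⊕ : ∀ {r} (w b : F2 r) → indicator zeroV (w ⊕ b) ≡ indicator b w
indicator-⊕ w b = indicator-≡
  (λ 0≡w⊕b → trans (sym (x⊕[x⊕y]≡y w b)) (trans (cong (w ⊕_) (sym 0≡w⊕b)) (⊕-identityʳ w)))
  (λ { refl → sym (x⊕x≡0 b) })

indicator-0∷ : ∀ {r} (w : F2 r) → indicator zeroV (false ∷ w) ≡ indicator zeroV w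
indicator-0∷ w = indicator-≡ (λ e → proj₂ (∷-injective e)) (cong (false ∷_))

laplacianℚ : ∀ {r n} → Vec (F2 r) n → (F2 r → ℚ) → F2 r → ℚ
laplacianℚ []      h w = 0ℚ
laplacianℚ (v ∷ M) h w = (h w - h (w ⊕ v)) + laplacianℚ M h w

fromℤ-laplacian : ∀ {r n} (M : Vec (F2 r) n) f w → fromℤ (laplacian M f w) ≡ laplacianℚ M (λ x → fromℤ (f x)) w
fromℤ-laplacian []      f w = cong fromℤ (ℤP.+-inverseʳ (+ 0 ℤ.* f w))
fromℤ-laplacian {n = suc n} (v ∷ M) f w = begin
  fromℤ (laplacian (v ∷ M) f w)                               ≡⟨ cong fromℤ (laplacian-∷ (+ n) (f w) (f (w ⊕ v)) _) ⟩
  fromℤ ((f w ℤ.- f (w ⊕ v)) ℤ.+ laplacian M f w)             ≡⟨ fromℤ-+ (f w ℤ.- f (w ⊕ v)) _ ⟩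
  fromℤ (f w ℤ.- f (w ⊕ v)) + fromℤ (laplacian M f w)         ≡⟨ cong₂ _+_ (fromℤ-- (f w) (f (w ⊕ v))) (fromℤ-laplacian M f w) ⟩
  (fromℤ (f w) - fromℤ (f (w ⊕ v))) + laplacianℚ M (λ x → fromℤ (f x)) w ∎
  where
  open ≡-Reasoning
  laplacian-∷ : ∀ n a b s → (+ 1 ℤ.+ n) ℤ.* a ℤ.- (b ℤ.+ s) ≡ (a ℤ.- b) ℤ.+ (n ℤ.* a ℤ.- s)
  laplacian-∷ = ℤRing.solve-∀

laplacianℚ-cong : ∀ {r n} (M : Vec (F2 r) n) {g h : F2 r → ℚ} → (∀ x → g x ≡ h x) → ∀ w →
                  laplacianℚ M g w ≡ laplacianℚ M h w
laplacianℚ-cong []      g≗h w = refl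
laplacianℚ-cong (v ∷ M) g≗h w = cong₂ _+_ (cong₂ _-_ (g≗h w) (g≗h (w ⊕ v))) (laplacianℚ-cong M g≗h w)

laplacianℚ-*ˡ : ∀ {r n} (M : Vec (F2 r) n) c h w → laplacianℚ M (λ x → c * h x) w ≡ c * laplacianℚ M h w
laplacianℚ-*ˡ []      c h w = sym (ℚP.*-zeroʳ c)
laplacianℚ-*ˡ (v ∷ M) c h w = trans (cong (_+_ (c * h w - c * h (w ⊕ v))) (laplacianℚ-*ˡ M c h w))
  (solve 4 (λ c a b d → (c :* a :- c :* b) :+ c :* d := c :* ((a :- b) :+ d)) refl c (h w) (h (w ⊕ v)) _)

laplacianℚ-- : ∀ {r n} (M : Vec (F2 r) n) g h w →
               laplacianℚ M (λ x → g x - h x) w ≡ laplacianℚ M g w - laplacianℚ M h w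
laplacianℚ-- []      g h w = refl
laplacianℚ-- (v ∷ M) g h w = trans (cong (_+_ ((g w - h w) - (g (w ⊕ v) - h (w ⊕ v)))) (laplacianℚ-- M g h w))
  (solve 6 (λ a b c d e f → ((a :- b) :- (c :- d)) :+ (e :- f) := ((a :- c) :+ e) :- ((b :- d) :+ f)) refl
     (g w) (h w) (g (w ⊕ v)) (h (w ⊕ v)) (laplacianℚ M g w) (laplacianℚ M h w))

laplacianℚ-∑ : ∀ {r n} (M : Vec (F2 r) n) (F : F2 r → F2 r → ℚ) w →
               laplacianℚ M (λ x → ∑ r (λ u → F u x)) w ≡ ∑ r (λ u → laplacianℚ M (F u) w)
laplacianℚ-∑ {r} []      F w = sym (sumℚ-map-0 (allVecs r))
laplacianℚ-∑ {r} (v ∷ M) F w = begin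
  (∑ r (λ u → F u w) - ∑ r (λ u → F u (w ⊕ v))) + laplacianℚ M (λ x → ∑ r (λ u → F u x)) w
    ≡⟨ cong₂ _+_ (sym (sumℚ-map-- (λ u → F u w) (λ u → F u (w ⊕ v)) (allVecs r))) (laplacianℚ-∑ M F w) ⟩
  ∑ r (λ u → F u w - F u (w ⊕ v)) + ∑ r (λ u → laplacianℚ M (F u) w)
    ≡⟨ sumℚ-map-+ (λ u → F u w - F u (w ⊕ v)) (λ u → laplacianℚ M (F u) w) (allVecs r) ⟨
  ∑ r (λ u → laplacianℚ (v ∷ M) (F u) w) ∎
  where open ≡-Reasoning

-- Eigenvectors, characters and the potential

bit : Bool → ℕ
bit true  = 1
bit false = 0

bitℚ : Bool → ℚ
bitℚ b = if b then 1ℚ else 0ℚ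

signℚ : Bool → ℚ
signℚ b = if b then 1ℚ else - 1ℚ

characterℚ : Bool → ℚ
characterℚ b = if b then - 1ℚ else 1ℚ

fromℤ-bit : ∀ b → fromℤ (+ bit b) ≡ bitℚ b
fromℤ-bit true  = refl
fromℤ-bit false = refl

bitℚ-xor : ∀ a b → bitℚ a - bitℚ (a xor b) ≡ bitℚ b * signℚ a
bitℚ-xor true  true  = refl
bitℚ-xor true  false = refl
bitℚ-xor false true  = refl
bitℚ-xor false false = refl

oddCount : ∀ {r n} → Vec (F2 r) n → F2 r → ℕ
oddCount []      u = 0
oddCount (v ∷ M) u = bit (dot u v) ℕ.+ oddCount M u

eigen≡2*oddCount : ∀ {r n} (M : Vec (F2 r) n) u → eigen M u ≡ + (oddCount M u ℕ.+ oddCount M u)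
eigen≡2*oddCount []                  u = refl
eigen≡2*oddCount {n = suc n} (v ∷ M) u = begin
  + (1 ℕ.+ n) ℤ.- (t ℤ.+ s)                  ≡⟨ eigen-∷ (+ n) t s ⟩
  (+ 1 ℤ.- t) ℤ.+ eigen M u                  ≡⟨ cong₂ ℤ._+_ (1-t≡2*bit (dot u v)) (eigen≡2*oddCount M u) ⟩
  + (b ℕ.+ b) ℤ.+ + (k ℕ.+ k)                ≡⟨ cong +_ (double-+ b k) ⟩
  + ((b ℕ.+ k) ℕ.+ (b ℕ.+ k))                ∎
  where
  open ≡-Reasoning
  term : F2 _ → ℤ
  term v = if dot u v then ℤ.-[1+ 0 ] else + 1
  t = term v
  s = sumℤ (Vec.map term M)
  b = bit (dot u v)
  k = oddCount M u
  eigen-∷ : ∀ n t s → (+ 1 ℤ.+ n) ℤ.- (t ℤ.+ s) ≡ (+ 1 ℤ.- t) ℤ.+ (n ℤ.- s)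
  eigen-∷ = ℤRing.solve-∀
  1-t≡2*bit : ∀ a → + 1 ℤ.- (if a then ℤ.-[1+ 0 ] else + 1) ≡ + (bit a ℕ.+ bit a)
  1-t≡2*bit true  = refl
  1-t≡2*bit false = refl
  double-+ : ∀ b k → (b ℕ.+ b) ℕ.+ (k ℕ.+ k) ≡ (b ℕ.+ k) ℕ.+ (b ℕ.+ k)
  double-+ = ℕRing.solve-∀

oddCount≡0⇒dot≡false : ∀ {r n} (M : Vec (F2 r) n) u → oddCount M u ≡ 0 → ∀ s → dot u (subsetSum M s) ≡ false
oddCount≡0⇒dot≡false []      u k≡0 []      = dot-zeroʳ u
oddCount≡0⇒dot≡false (v ∷ M) u k≡0 (b ∷ s) = begin
  dot u ((if b then v else zeroV) ⊕ subsetSum M s)           ≡⟨ dot-⊕ʳ u _ (subsetSum M s) ⟩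
  dot u (if b then v else zeroV) xor dot u (subsetSum M s)
    ≡⟨ cong₂ _xor_ (chosen b) (oddCount≡0⇒dot≡false M u (ℕP.m+n≡0⇒n≡0 (bit (dot u v)) k≡0) s) ⟩
  false                                                      ∎
  where
  open ≡-Reasoning
  bit≡0⇒false : ∀ a → bit a ≡ 0 → a ≡ false
  bit≡0⇒false false _ = refl
  chosen : ∀ b → dot u (if b then v else zeroV) ≡ false
  chosen true  = bit≡0⇒false (dot u v) (ℕP.m+n≡0⇒m≡0 (bit (dot u v)) k≡0)
  chosen false = dot-zeroʳ u

oddCount-nonzero : ∀ {r n} (M : Vec (F2 r) n) → Generates M → ∀ u j → lookup u j ≡ true →
                   ∃ λ k → oddCount M u ≡ suc k
oddCount-nonzero M gen u j uⱼ≡1 with oddCount M u in k≡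
... | suc k = k , refl
... | zero with gen (basis j)
...   | s , Ms≡eⱼ
  with trans (sym (oddCount≡0⇒dot≡false M u k≡ s)) (trans (cong (dot u) Ms≡eⱼ) (trans (dot-basisʳ u j) uⱼ≡1))
...     | ()

laplacianℚ-bitℚ : ∀ {r n} (M : Vec (F2 r) n) u w →
                  laplacianℚ M (λ x → bitℚ (dot u x)) w ≡ fromℤ (+ oddCount M u) * signℚ (dot u w)
laplacianℚ-bitℚ []      u w = sym (ℚP.*-zeroˡ (signℚ (dot u w)))
laplacianℚ-bitℚ (v ∷ M) u w = begin
  (bitℚ a - bitℚ (dot u (w ⊕ v))) + laplacianℚ M (λ x → bitℚ (dot u x)) w
    ≡⟨ cong₂ (λ c d → (bitℚ a - bitℚ c) + d) (dot-⊕ʳ u w v) (laplacianℚ-bitℚ M u w) ⟩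
  (bitℚ a - bitℚ (a xor b)) + fromℤ (+ k) * signℚ a   ≡⟨ cong (_+ fromℤ (+ k) * signℚ a) (bitℚ-xor a b) ⟩
  bitℚ b * signℚ a + fromℤ (+ k) * signℚ a            ≡⟨ ℚP.*-distribʳ-+ (signℚ a) (bitℚ b) (fromℤ (+ k)) ⟨
  (bitℚ b + fromℤ (+ k)) * signℚ a                    ≡⟨ cong (λ c → (c + fromℤ (+ k)) * signℚ a) (fromℤ-bit b) ⟨
  (fromℤ (+ bit b) + fromℤ (+ k)) * signℚ a           ≡⟨ cong (_* signℚ a) (fromℤ-+ (+ bit b) (+ k)) ⟨
  fromℤ (+ (bit b ℕ.+ k)) * signℚ a                   ∎
  where
  open ≡-Reasoning
  a = dot u w
  b = dot u v
  k = oddCount M u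

∑-character : ∀ r (w : F2 r) → ∑ r (λ u → characterℚ (dot u w)) ≡ fromℤ (+ 2 ^ r) * fromℤ (indicator zeroV w)
∑-character zero    []          = refl
∑-character (suc r) (false ∷ w) = begin
  ∑ (suc r) (λ u → characterℚ (dot u (false ∷ w)))                    ≡⟨ ∑-suc r _ ⟩
  ∑ r (λ u → characterℚ (dot u w)) + ∑ r (λ u → characterℚ (dot u w))    ≡⟨ cong₂ _+_ (∑-character r w) (∑-character r w) ⟩
  p * δ + p * δ                                                    ≡⟨ ℚP.*-distribʳ-+ δ p p ⟨
  (p + p) * δ                                                      ≡⟨ cong₂ _*_ (fromℤ-2^suc r) (cong fromℤ (indicator-0∷ w)) ⟨
  fromℤ (+ 2 ^ suc r) * fromℤ (indicator zeroV (false ∷ w))        ∎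
  where
  open ≡-Reasoning
  p = fromℤ (+ 2 ^ r)
  δ = fromℤ (indicator zeroV w)
  fromℤ-2^suc : ∀ r → fromℤ (+ 2 ^ suc r) ≡ fromℤ (+ 2 ^ r) + fromℤ (+ 2 ^ r)
  fromℤ-2^suc r = trans (cong (λ m → fromℤ (+ (2 ^ r ℕ.+ m))) (ℕP.+-identityʳ (2 ^ r))) (fromℤ-+ (+ 2 ^ r) (+ 2 ^ r))
∑-character (suc r) (true ∷ w) = begin
  ∑ (suc r) (λ u → characterℚ (dot u (true ∷ w)))  ≡⟨ ∑-suc r _ ⟩
  ∑ r (λ u → characterℚ (dot u w)) + ∑ r (λ u → characterℚ (not (dot u w)))
    ≡⟨ cong (_+_ (∑ r (λ u → characterℚ (dot u w)))) (sumℚ-map-cong (λ u → character-not (dot u w)) (allVecs r)) ⟩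
  ∑ r (λ u → characterℚ (dot u w)) + ∑ r (λ u → - characterℚ (dot u w))
    ≡⟨ cong (_+_ (∑ r (λ u → characterℚ (dot u w)))) (sumℚ-map-neg (λ u → characterℚ (dot u w)) (allVecs r)) ⟩
  ∑ r (λ u → characterℚ (dot u w)) - ∑ r (λ u → characterℚ (dot u w))     ≡⟨ ℚP.+-inverseʳ (∑ r (λ u → characterℚ (dot u w))) ⟩
  0ℚ                                                               ≡⟨ ℚP.*-zeroʳ (fromℤ (+ 2 ^ suc r)) ⟨
  fromℤ (+ 2 ^ suc r) * 0ℚ                                         ≡⟨ cong (λ i → fromℤ (+ 2 ^ suc r) * fromℤ i) (indicator-≢ {a = zeroV} {true ∷ w} (λ ())) ⟨
  fromℤ (+ 2 ^ suc r) * fromℤ (indicator zeroV (true ∷ w))         ∎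
  where
  open ≡-Reasoning
  character-not : ∀ a → characterℚ (not a) ≡ - characterℚ a
  character-not true  = refl
  character-not false = refl

signSum : ∀ r → Fin r → F2 r → ℚ
signSum r j w = ∑ r (λ u → if lookup u j then signℚ (dot u w) else 0ℚ)

2*signSum : ∀ r (j : Fin r) w → fromℤ (+ 2) * signSum r j w ≡ fromℤ (+ 2 ^ r) * fromℤ (xMinus1 j w)
2*signSum r j w = begin
  fromℤ (+ 2) * signSum r j w
    ≡⟨ sumℚ-map-*ˡ (fromℤ (+ 2)) (λ u → if lookup u j then signℚ (dot u w) else 0ℚ) (allVecs r) ⟨
  ∑ r (λ u → fromℤ (+ 2) * (if lookup u j then signℚ (dot u w) else 0ℚ))
    ≡⟨ sumℚ-map-cong term (allVecs r) ⟩
  ∑ r (λ u → characterℚ (dot u (w ⊕ basis j)) - characterℚ (dot u w))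
    ≡⟨ sumℚ-map-- (λ u → characterℚ (dot u (w ⊕ basis j))) (λ u → characterℚ (dot u w)) (allVecs r) ⟩
  ∑ r (λ u → characterℚ (dot u (w ⊕ basis j))) - ∑ r (λ u → characterℚ (dot u w))
    ≡⟨ cong₂ _-_ (∑-character r (w ⊕ basis j)) (∑-character r w) ⟩
  p * fromℤ (indicator zeroV (w ⊕ basis j)) - p * fromℤ (indicator zeroV w)
    ≡⟨ cong (λ i → p * fromℤ i - p * fromℤ (indicator zeroV w)) (indicator-⊕ w (basis j)) ⟩
  p * fromℤ (indicator (basis j) w) - p * fromℤ (indicator zeroV w)
    ≡⟨ solve 3 (λ p a b → p :* a :- p :* b := p :* (a :- b)) refl p _ _ ⟩
  p * (fromℤ (indicator (basis j) w) - fromℤ (indicator zeroV w))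
    ≡⟨ cong (p *_) (fromℤ-- (indicator (basis j) w) (indicator zeroV w)) ⟨
  p * fromℤ (xMinus1 j w) ∎
  where
  open ≡-Reasoning
  p = fromℤ (+ 2 ^ r)
  2*sign : ∀ a c → fromℤ (+ 2) * (if c then signℚ a else 0ℚ) ≡ characterℚ (a xor c) - characterℚ a
  2*sign true  true  = refl
  2*sign true  false = refl
  2*sign false true  = refl
  2*sign false false = refl
  term : ∀ u → fromℤ (+ 2) * (if lookup u j then signℚ (dot u w) else 0ℚ) ≡
               characterℚ (dot u (w ⊕ basis j)) - characterℚ (dot u w)
  term u = trans (2*sign (dot u w) (lookup u j))
    (cong (λ c → characterℚ c - characterℚ (dot u w)) (sym (trans (dot-⊕ʳ u w (basis j)) (cong (dot u w xor_) (dot-basisʳ u j)))))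

weight : ∀ {r n} → Vec (F2 r) n → Fin r → F2 r → ℚ
weight M j u = if lookup u j then recip (eigen M u) else 0ℚ

innerSum≡∑weight : ∀ {r n} (M : Vec (F2 r) n) j w → innerSum M j w ≡ ∑ r (λ u → weight M j u * bitℚ (dot u w))
innerSum≡∑weight {r} M j w = sumℚ-map-cong term (allVecs r)
  where
  term : ∀ u → (if dot u w ∧ lookup u j then recip (eigen M u) else 0ℚ) ≡ weight M j u * bitℚ (dot u w)
  term u with dot u w | lookup u j
  ... | true  | true  = sym (ℚP.*-identityʳ (recip (eigen M u)))
  ... | true  | false = sym (ℚP.*-zeroˡ 1ℚ)
  ... | false | true  = sym (ℚP.*-zeroʳ (recip (eigen M u)))
  ... | false | false = sym (ℚP.*-zeroˡ 0ℚ)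

weight*eigenvalue : ∀ {r n} (M : Vec (F2 r) n) → Generates M → ∀ j u w →
                    weight M j u * (fromℤ (+ oddCount M u) * signℚ (dot u w)) ≡
                    (+ 1 / 2) * (if lookup u j then signℚ (dot u w) else 0ℚ)
weight*eigenvalue M gen j u w with lookup u j in uⱼ≡
... | false = trans (ℚP.*-zeroˡ (fromℤ (+ oddCount M u) * signℚ (dot u w))) (sym (ℚP.*-zeroʳ (+ 1 / 2)))
... | true with oddCount-nonzero M gen u j uⱼ≡
...   | k , k≡ rewrite eigen≡2*oddCount M u | k≡ = begin
  (+ 1 / (suc k ℕ.+ suc k)) * (fromℤ (+ suc k) * signℚ (dot u w))
    ≡⟨ ℚP.*-assoc (+ 1 / (suc k ℕ.+ suc k)) (fromℤ (+ suc k)) (signℚ (dot u w)) ⟨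
  ((+ 1 / (suc k ℕ.+ suc k)) * fromℤ (+ suc k)) * signℚ (dot u w)
    ≡⟨ cong (_* signℚ (dot u w)) ([1/2k]*k≡1/2 k) ⟩
  (+ 1 / 2) * signℚ (dot u w) ∎
  where open ≡-Reasoning

laplacianℚ-innerSum : ∀ {r n} (M : Vec (F2 r) n) → Generates M → ∀ j w →
                      laplacianℚ M (innerSum M j) w ≡ (+ 1 / 2) * signSum r j w
laplacianℚ-innerSum {r} M gen j w = begin
  laplacianℚ M (innerSum M j) w
    ≡⟨ laplacianℚ-cong M (innerSum≡∑weight M j) w ⟩
  laplacianℚ M (λ x → ∑ r (λ u → weight M j u * bitℚ (dot u x))) w
    ≡⟨ laplacianℚ-∑ M (λ u x → weight M j u * bitℚ (dot u x)) w ⟩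
  ∑ r (λ u → laplacianℚ M (λ x → weight M j u * bitℚ (dot u x)) w)
    ≡⟨ sumℚ-map-cong eigenvector (allVecs r) ⟩
  ∑ r (λ u → (+ 1 / 2) * (if lookup u j then signℚ (dot u w) else 0ℚ))
    ≡⟨ sumℚ-map-*ˡ (+ 1 / 2) (λ u → if lookup u j then signℚ (dot u w) else 0ℚ) (allVecs r) ⟩
  (+ 1 / 2) * signSum r j w ∎
  where
  open ≡-Reasoning
  eigenvector : ∀ u → laplacianℚ M (λ x → weight M j u * bitℚ (dot u x)) w ≡
                      (+ 1 / 2) * (if lookup u j then signℚ (dot u w) else 0ℚ)
  eigenvector u = trans (laplacianℚ-*ˡ M (weight M j u) (λ x → bitℚ (dot u x)) w)
    (trans (cong (weight M j u *_) (laplacianℚ-bitℚ M u w)) (weight*eigenvalue M gen j u w))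

potential : ∀ {r n} → Vec (F2 r) n → Fin r → F2 r → ℚ
potential {r} M j w = scale r 1 * innerSum M j w

scale≡D*scale1 : ∀ r D → scale r D ≡ fromℤ (+ D) * scale r 1
scale≡D*scale1 r D = begin
  _/_ (+ (4 ℕ.* D)) (2 ^ r) {{ℕP.m^n≢0 2 r}}  ≡⟨ cong (λ i → _/_ i (2 ^ r) {{ℕP.m^n≢0 2 r}}) (trans (cong +_ (ℕP.*-comm 4 D)) (ℤP.pos-* D 4)) ⟩
  _/_ (+ D ℤ.* + 4) (2 ^ r) {{ℕP.m^n≢0 2 r}}  ≡⟨ *-/ (+ D) (+ 4) (2 ^ r) {{ℕP.m^n≢0 2 r}} ⟩
  fromℤ (+ D) * scale r 1                    ∎
  where open ≡-Reasoning

scale1≡2*2*[1/2^r] : ∀ r → scale r 1 ≡ fromℤ (+ 2) * (fromℤ (+ 2) * _/_ (+ 1) (2 ^ r) {{ℕP.m^n≢0 2 r}})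
scale1≡2*2*[1/2^r] r =
  trans (*-/ (+ 2) (+ 2) (2 ^ r) {{ℕP.m^n≢0 2 r}}) (cong (fromℤ (+ 2) *_) (*-/ (+ 2) (+ 1) (2 ^ r) {{ℕP.m^n≢0 2 r}}))

scale*innerSum≡D*potential : ∀ {r n} (M : Vec (F2 r) n) j D v → scale r D * innerSum M j v ≡ fromℤ (+ D) * potential M j v
scale*innerSum≡D*potential {r} M j D v =
  trans (cong (_* innerSum M j v) (scale≡D*scale1 r D)) (ℚP.*-assoc (fromℤ (+ D)) (scale r 1) (innerSum M j v))

potential-zero : ∀ {r n} (M : Vec (F2 r) n) j → potential M j zeroV ≡ 0ℚ
potential-zero {r} M j =
  trans (cong (scale r 1 *_) (trans (sumℚ-map-cong term (allVecs r)) (sumℚ-map-0 (allVecs r)))) (ℚP.*-zeroʳ (scale r 1))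
  where
  term : ∀ u → (if dot u zeroV ∧ lookup u j then recip (eigen M u) else 0ℚ) ≡ 0ℚ
  term u rewrite dot-zeroʳ u = refl

laplacianℚ-potential : ∀ {r n} (M : Vec (F2 r) n) → Generates M → ∀ j w →
                       laplacianℚ M (potential M j) w ≡ fromℤ (xMinus1 j w)
laplacianℚ-potential {r} M gen j w = begin
  laplacianℚ M (potential M j) w              ≡⟨ laplacianℚ-*ˡ M (scale r 1) (innerSum M j) w ⟩
  scale r 1 * laplacianℚ M (innerSum M j) w   ≡⟨ cong₂ _*_ (scale1≡2*2*[1/2^r] r) (laplacianℚ-innerSum M gen j w) ⟩
  (two * (two * q)) * (half * T)              ≡⟨ solve 4 (λ t q h s → (t :* (t :* q)) :* (h :* s) := (t :* h) :* (q :* (t :* s))) refl two q half T ⟩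
  (two * half) * (q * (two * T))              ≡⟨ cong₂ (λ a b → a * (q * b)) (n*[1/n]≡1 2) (2*signSum r j w) ⟩
  1ℚ * (q * (p * G))                          ≡⟨ solve 3 (λ q p g → con 1ℚ :* (q :* (p :* g)) := (p :* q) :* g) refl q p G ⟩
  (p * q) * G                                 ≡⟨ cong (_* G) (n*[1/n]≡1 (2 ^ r) {{ℕP.m^n≢0 2 r}}) ⟩
  1ℚ * G                                      ≡⟨ ℚP.*-identityˡ G ⟩
  G                                           ∎
  where
  open ≡-Reasoning
  two = fromℤ (+ 2)
  half = + 1 / 2
  p = fromℤ (+ 2 ^ r)
  q = _/_ (+ 1) (2 ^ r) {{ℕP.m^n≢0 2 r}}
  T = signSum r j w
  G = fromℤ (xMinus1 j w)

-- Harmonic functions are constant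

argmax : ∀ r (h : F2 r → ℚ) → ∃ λ m → ∀ w → h w ≤ h m
argmax zero    h = [] , λ { [] → ℚP.≤-refl }
argmax (suc r) h with argmax r (λ u → h (false ∷ u)) | argmax r (λ u → h (true ∷ u))
... | m₀ , max₀ | m₁ , max₁ with ℚP.≤-total (h (false ∷ m₀)) (h (true ∷ m₁))
...   | inj₁ h₀≤h₁ = true ∷ m₁ , λ { (false ∷ w) → ℚP.≤-trans (max₀ w) h₀≤h₁ ; (true ∷ w) → max₁ w }
...   | inj₂ h₁≤h₀ = false ∷ m₀ , λ { (false ∷ w) → max₀ w ; (true ∷ w) → ℚP.≤-trans (max₁ w) h₁≤h₀ }

q≤p⇒0≤p-q : ∀ {p q} → q ≤ p → 0ℚ ≤ p - q
q≤p⇒0≤p-q {p} {q} q≤p = subst (_≤ p - q) (ℚP.+-inverseʳ q) (ℚP.+-monoˡ-≤ (- q) q≤p)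

nonneg-+≡0 : ∀ {p q} → 0ℚ ≤ p → 0ℚ ≤ q → p + q ≡ 0ℚ → p ≡ 0ℚ × q ≡ 0ℚ
nonneg-+≡0 {p} {q} 0≤p 0≤q p+q≡0 = p≡0 , trans (sym (ℚP.+-identityˡ q)) (trans (cong (_+ q) (sym p≡0)) p+q≡0)
  where
  p≡0 : p ≡ 0ℚ
  p≡0 = ℚP.≤-antisym (subst (p ≤_) p+q≡0 (subst (_≤ p + q) (ℚP.+-identityʳ p) (ℚP.+-monoʳ-≤ p 0≤q))) 0≤p

p-q≡0⇒q≡p : ∀ p q → p - q ≡ 0ℚ → q ≡ p
p-q≡0⇒q≡p p q p-q≡0 = begin
  q                ≡⟨ solve 2 (λ p q → q := p :- (p :- q)) refl p q ⟩
  p - (p - q)      ≡⟨ cong (λ x → p - x) p-q≡0 ⟩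
  p - 0ℚ           ≡⟨ solve 1 (λ p → p :- con 0ℚ := p) refl p ⟩
  p                ∎
  where open ≡-Reasoning

laplacianℚ-nonneg : ∀ {r n} (M : Vec (F2 r) n) h x → (∀ i → h (x ⊕ lookup M i) ≤ h x) → 0ℚ ≤ laplacianℚ M h x
laplacianℚ-nonneg []      h x max = ℚP.≤-refl
laplacianℚ-nonneg (v ∷ M) h x max =
  ℚP.+-mono-≤ (q≤p⇒0≤p-q (max zero)) (laplacianℚ-nonneg M h x (λ i → max (suc i)))

laplacianℚ≡0⇒flat : ∀ {r n} (M : Vec (F2 r) n) h x → (∀ i → h (x ⊕ lookup M i) ≤ h x) →
                    laplacianℚ M h x ≡ 0ℚ → ∀ i → h (x ⊕ lookup M i) ≡ h x
laplacianℚ≡0⇒flat (v ∷ M) h x max L≡0 i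
  with nonneg-+≡0 (q≤p⇒0≤p-q (max zero)) (laplacianℚ-nonneg M h x (λ i → max (suc i))) L≡0
... | edge≡0 , rest≡0 with i
...   | zero  = p-q≡0⇒q≡p (h x) (h (x ⊕ v)) edge≡0
...   | suc i = laplacianℚ≡0⇒flat M h x (λ i → max (suc i)) rest≡0 i

subsetSum-closed : ∀ {r n} (M : Vec (F2 r) n) (P : F2 r → Set) → (∀ x i → P x → P (x ⊕ lookup M i)) →
                   ∀ x s → P x → P (x ⊕ subsetSum M s)
subsetSum-closed []      P step x []      Px = subst P (sym (⊕-identityʳ x)) Px
subsetSum-closed (v ∷ M) P step x (b ∷ s) Px =
  subst P (⊕-assoc x _ (subsetSum M s)) (subsetSum-closed M P (λ y i → step y (suc i)) _ s (move b))
  where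
  move : ∀ b → P (x ⊕ (if b then v else zeroV))
  move true  = step x zero Px
  move false = subst P (sym (⊕-identityʳ x)) Px

generators-closed⇒universal : ∀ {r n} (M : Vec (F2 r) n) → Generates M → (P : F2 r → Set) →
                              (∀ x i → P x → P (x ⊕ lookup M i)) → ∀ x → P x → ∀ w → P w
generators-closed⇒universal M gen P step x Px w with gen (x ⊕ w)
... | s , Ms≡x⊕w =
  subst P (trans (cong (x ⊕_) Ms≡x⊕w) (x⊕[x⊕y]≡y x w)) (subsetSum-closed M P step x s Px)

harmonic⇒constant : ∀ {r n} (M : Vec (F2 r) n) → Generates M → (h : F2 r → ℚ) →
                    (∀ w → laplacianℚ M h w ≡ 0ℚ) → ∀ w → h w ≡ h zeroV
harmonic⇒constant {r} M gen h harmonic w with argmax r h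
... | m , max = trans (maximal w) (sym (maximal zeroV))
  where
  step : ∀ x i → h x ≡ h m → h (x ⊕ lookup M i) ≡ h m
  step x i hx≡hm =
    trans (laplacianℚ≡0⇒flat M h x (λ i → subst (h (x ⊕ lookup M i) ≤_) (sym hx≡hm) (max _)) (harmonic x) i) hx≡hm
  maximal : ∀ w → h w ≡ h m
  maximal = generators-closed⇒universal M gen (λ x → h x ≡ h m) step m refl

-- Multiples of x_j − 1 in the image of L

image⇒integral : ∀ {r n} (M : Vec (F2 r) n) → Generates M → ∀ j D →
                 InImage M (λ w → + D ℤ.* xMinus1 j w) → IntegralityCondition M j D
image⇒integral {r} M gen j D (f , Lf≡Dg) v = f v ℤ.- f zeroV , (begin
  scale r D * innerSum M j v                  ≡⟨ scale*innerSum≡D*potential M j D v ⟩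
  d * P v                                     ≡⟨ solve 2 (λ a x → x := a :- (a :- x)) refl (F v) (d * P v) ⟩
  F v - h v                                   ≡⟨ cong (λ x → F v - x) (harmonic⇒constant M gen h harmonic v) ⟩
  F v - (F zeroV - d * P zeroV)               ≡⟨ cong (λ x → F v - (F zeroV - d * x)) (potential-zero M j) ⟩
  F v - (F zeroV - d * 0ℚ)                    ≡⟨ solve 3 (λ a b d → a :- (b :- d :* con 0ℚ) := a :- b) refl (F v) (F zeroV) d ⟩
  F v - F zeroV                               ≡⟨ fromℤ-- (f v) (f zeroV) ⟨
  fromℤ (f v ℤ.- f zeroV)                     ∎)
  where
  open ≡-Reasoning
  d = fromℤ (+ D)
  F = λ x → fromℤ (f x)
  P = potential M j
  h : F2 r → ℚ
  h x = F x - d * P x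
  harmonic : ∀ w → laplacianℚ M h w ≡ 0ℚ
  harmonic w = begin
    laplacianℚ M h w                                    ≡⟨ laplacianℚ-- M F (λ x → d * P x) w ⟩
    laplacianℚ M F w - laplacianℚ M (λ x → d * P x) w   ≡⟨ cong₂ _-_ (sym (fromℤ-laplacian M f w)) (laplacianℚ-*ˡ M d P w) ⟩
    fromℤ (laplacian M f w) - d * laplacianℚ M P w
      ≡⟨ cong₂ _-_ (trans (cong fromℤ (Lf≡Dg w)) (fromℤ-* (+ D) (xMinus1 j w))) (cong (d *_) (laplacianℚ-potential M gen j w)) ⟩
    d * fromℤ (xMinus1 j w) - d * fromℤ (xMinus1 j w)   ≡⟨ ℚP.+-inverseʳ (d * fromℤ (xMinus1 j w)) ⟩
    0ℚ                                                  ∎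

integral⇒image : ∀ {r n} (M : Vec (F2 r) n) → Generates M → ∀ j D →
                 IntegralityCondition M j D → InImage M (λ w → + D ℤ.* xMinus1 j w)
integral⇒image {r} M gen j D integral = f , λ w → fromℤ-injective (begin
  fromℤ (laplacian M f w)                        ≡⟨ fromℤ-laplacian M f w ⟩
  laplacianℚ M (λ x → fromℤ (f x)) w             ≡⟨ laplacianℚ-cong M f≡D*potential w ⟩
  laplacianℚ M (λ x → d * potential M j x) w     ≡⟨ laplacianℚ-*ˡ M d (potential M j) w ⟩
  d * laplacianℚ M (potential M j) w             ≡⟨ cong (d *_) (laplacianℚ-potential M gen j w) ⟩
  d * fromℤ (xMinus1 j w)                        ≡⟨ fromℤ-* (+ D) (xMinus1 j w) ⟨
  fromℤ (+ D ℤ.* xMinus1 j w)                    ∎)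
  where
  open ≡-Reasoning
  d = fromℤ (+ D)
  f : F2 r → ℤ
  f v = proj₁ (integral v)
  f≡D*potential : ∀ v → fromℤ (f v) ≡ d * potential M j v
  f≡D*potential v = trans (sym (proj₂ (integral v))) (scale*innerSum≡D*potential M j D v)

-- Existence of the least positive solution

isInteger? : ∀ q → Dec (IsInteger q)
isInteger? q with ↧ₙ q ℕ.≟ 1
... | yes ↧q≡1 = yes (↥ q , trans (sym (ℚP.↥p/↧p≡p q)) (ℚP./-cong {↥ q} refl ↧q≡1))
... | no ↧q≢1  = no λ { (z , q≡z) → ↧q≢1 (cong ↧ₙ_ (trans q≡z (fromℤ≡mkℚ z))) }

all? : ∀ r {P : F2 r → Set} → (∀ v → Dec (P v)) → Dec (∀ v → P v)
all? zero    P? = map′ (λ P[] → λ { [] → P[] }) (λ ∀P → ∀P []) (P? [])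
all? (suc r) P? = map′ (λ { (P₀ , P₁) → λ { (false ∷ v) → P₀ v ; (true ∷ v) → P₁ v } })
                       (λ ∀P → (λ v → ∀P (false ∷ v)) , (λ v → ∀P (true ∷ v)))
                       (all? r (λ v → P? (false ∷ v)) ×-dec all? r (λ v → P? (true ∷ v)))

integrality? : ∀ {r n} (M : Vec (F2 r) n) j D → Dec (IntegralityCondition M j D)
integrality? {r} M j D = all? r (λ v → isInteger? (scale r D * innerSum M j v))

IsInteger-multiple : ∀ E D q → IsInteger (fromℤ (+ D) * q) → IsInteger (fromℤ (+ (E ℕ.* D)) * q)
IsInteger-multiple E D q (z , Dq≡z) = + E ℤ.* z , (begin
  fromℤ (+ (E ℕ.* D)) * q           ≡⟨ cong (λ i → fromℤ i * q) (ℤP.pos-* E D) ⟩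
  fromℤ (+ E ℤ.* + D) * q           ≡⟨ cong (_* q) (fromℤ-* (+ E) (+ D)) ⟩
  (fromℤ (+ E) * fromℤ (+ D)) * q   ≡⟨ ℚP.*-assoc (fromℤ (+ E)) (fromℤ (+ D)) q ⟩
  fromℤ (+ E) * (fromℤ (+ D) * q)   ≡⟨ cong (fromℤ (+ E) *_) Dq≡z ⟩
  fromℤ (+ E) * fromℤ z             ≡⟨ fromℤ-* (+ E) z ⟨
  fromℤ (+ E ℤ.* z)                 ∎)
  where open ≡-Reasoning

commonDenominator : ∀ r (q : F2 r → ℚ) → ∃ λ D → 0 ℕ.< D × (∀ v → IsInteger (fromℤ (+ D) * q v))
commonDenominator zero    q = ↧ₙ q [] , 0<↧ₙ (q []) , λ { [] → ↥ q [] , denominator*q≡numerator (q []) }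
  where
  0<↧ₙ : ∀ p → 0 ℕ.< ↧ₙ p
  0<↧ₙ (mkℚ _ _ _) = s≤s z≤n
commonDenominator (suc r) q with commonDenominator r (λ v → q (false ∷ v)) | commonDenominator r (λ v → q (true ∷ v))
... | D₀ , 0<D₀ , int₀ | D₁ , 0<D₁ , int₁ = D₀ ℕ.* D₁ , ℕP.*-mono-< 0<D₀ 0<D₁ , λ
  { (false ∷ v) → subst (λ D → IsInteger (fromℤ (+ D) * q (false ∷ v))) (ℕP.*-comm D₁ D₀)
                        (IsInteger-multiple D₁ D₀ (q (false ∷ v)) (int₀ v))
  ; (true ∷ v)  → IsInteger-multiple D₀ D₁ (q (true ∷ v)) (int₁ v) }

integrality-satisfiable : ∀ {r n} (M : Vec (F2 r) n) j → ∃ λ D → 0 ℕ.< D × IntegralityCondition M j D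
integrality-satisfiable {r} M j with commonDenominator r (potential M j)
... | D , 0<D , int = D , 0<D , λ v → subst IsInteger (sym (scale*innerSum≡D*potential M j D v)) (int v)

module _ (P : ℕ → Set) (P? : ∀ D → Dec (P D)) where

  private
    searchUpTo : ∀ N → (∀ D → 0 ℕ.< D → D ℕ.≤ N → ¬ P D) ⊎ ∃ (IsLeastPos P)
    searchUpTo zero = inj₁ λ { _ () z≤n }
    searchUpTo (suc N) with searchUpTo N
    ... | inj₂ least = inj₂ least
    ... | inj₁ none with P? (suc N)
    ...   | yes P[N+1] = inj₂ (suc N , s≤s z≤n , P[N+1] , λ D 0<D PD → ℕP.≮⇒≥ (λ D<N+1 → none D 0<D (ℕP.≤-pred D<N+1) PD))
    ...   | no ¬P[N+1] = inj₁ λ D 0<D D≤N+1 PD → [ (λ D<N+1 → none D 0<D (ℕP.≤-pred D<N+1) PD)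
                                                 , (λ { refl → ¬P[N+1] PD }) ]′ (ℕP.m≤n⇒m<n∨m≡n D≤N+1)

  leastPositive : ∃ (λ D → 0 ℕ.< D × P D) → ∃ (IsLeastPos P)
  leastPositive (D , 0<D , PD) with searchUpTo D
  ... | inj₁ none  = ⊥-elim (none D 0<D ℕP.≤-refl PD)
  ... | inj₂ least = least

IsLeastPos-⇔ : ∀ {P Q : ℕ → Set} {C} → (∀ D → P D → Q D) → (∀ D → Q D → P D) → IsLeastPos P C → IsLeastPos Q C
IsLeastPos-⇔ P⇒Q Q⇒P (0<C , PC , least) = 0<C , P⇒Q _ PC , λ D 0<D QD → least D 0<D (Q⇒P D QD)

-- Loops (vᵢ = 0) contribute nothing to L(G) nor to λ_u.
mainTheorem6 : ∀ {r n : ℕ} (M : Vec (F2 r) n) → AllNonzero M → Generates M → (j : Fin r) →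
                 ∃ λ (C : ℕ) → IsOrderInCoker M (xMinus1 j) C × IsLeastPos (IntegralityCondition M j) C
mainTheorem6 M _ gen j =
  let C , least = leastPositive (IntegralityCondition M j) (integrality? M j) (integrality-satisfiable M j)
  in  C , IsLeastPos-⇔ (integral⇒image M gen j) (image⇒integral M gen j) least , least
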